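{- Let $C\subseteq\mathbb{Z}_2^n$ be a cap of dimension $7$ with basis $B$ and dependent set $D=C\setminus B$. Let $x_1,x_2\in D$ be distinct elements each of which is the sum of exactly five elements of $B$. Then $|B_{x_1}\cap B_{x_2}|$ equals $2$ or $3$.
   Context: Work in $\mathbb{Z}_2^n$. An affine combination of a set is a sum of an odd number of its distinct elements; $\operatorname{aff}(S)$ is the set of all affine combinations of elements of $S$, and the dimension of $S$ is the dimension of the affine flat $\operatorname{aff}(S)$. A basis for $S$ is a subset $B\subseteq S$ that is affinely independent (no element is an affine combination of the others) with $\operatorname{aff}(B)=\operatorname{aff}(S)$; its dependent set is $D=S\setminus B$. For $x\in D$, $B_x$ is the unique subset of $B$ whose elements sum to $x$. A quad is a set of four distinct elements summing to $\mathbf{0}$; a cap is a quad-free subset. -}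

module Defs where

open import Data.Bool using (Bool; true; false; _xor_)
open import Data.Bool.Properties using () renaming (_≟_ to _≟ᵇ_)
open import Data.Nat using (ℕ; zero; suc)
open import Data.Nat.Properties using ()
open import Data.Vec using (Vec; zipWith; replicate)
open import Data.Vec.Properties using (≡-dec)
open import Data.List using (List; []; _∷_; length; filter)
open import Data.List.Relation.Unary.All using (All)
open import Data.List.Relation.Unary.Unique.Propositional using (Unique)
open import Data.List.Membership.Propositional using (_∈_; _∉_)
open import Data.Product using (Σ; ∃; _×_; _,_)
open import Relation.Binary.PropositionalEquality using (_≡_; _≢_)
open import Relation.Binary.Definitions using (DecidableEquality)
open import Relation.Nullary using (¬_)
import Data.List.Membership.DecPropositional as DecMem

data Odd : ℕ → Set where
  odd-one : Odd 1
  odd-ss  : ∀ {k} → Odd k → Odd (suc (suc k))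

V : ℕ → Set
V n = Vec Bool n

_⊕_ : ∀ {n} → V n → V n → V n
_⊕_ = zipWith _xor_

𝟎 : ∀ {n} → V n
𝟎 = replicate _ false

_≟V_ : ∀ {n} → DecidableEquality (V n)
_≟V_ = ≡-dec _≟ᵇ_

sumV : ∀ {n} → List (V n) → V n
sumV []       = 𝟎
sumV (x ∷ xs) = x ⊕ sumV xs

-- Finite subsets of Z_2^n are represented by duplicate-free lists.
-- L is a list of distinct elements of S
DistinctIn : ∀ {n} → List (V n) → List (V n) → Set
DistinctIn L S = Unique L × All (_∈ S) L

InAff : ∀ {n} → List (V n) → V n → Set
InAff S x = ∃ λ L → DistinctIn L S × Odd (length L) × sumV L ≡ x

_⊆_ : ∀ {n} → List (V n) → List (V n) → Set
B ⊆ S = All (_∈ S) B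

remove : ∀ {n} → V n → List (V n) → List (V n)
remove {n} x = filter (λ y → ¬? (y ≟V x))
  where open import Relation.Nullary.Decidable using (¬?)

AffIndep : ∀ {n} → List (V n) → Set
AffIndep B = ∀ x → x ∈ B → ¬ InAff (remove x B) x

IsBasis : ∀ {n} → List (V n) → List (V n) → Set
IsBasis B S = Unique B × B ⊆ S × AffIndep B
            × (∀ x → (InAff B x → InAff S x) × (InAff S x → InAff B x))

-- S has (affine) dimension d: aff(S) has an affine basis (an affinely
-- independent spanning set, which may be taken inside S) of d+1 points
HasDim : ∀ {n} → List (V n) → ℕ → Set
HasDim S d = ∃ λ B → IsBasis B S × length B ≡ suc d

IsCap : ∀ {n} → List (V n) → Set
IsCap C = ∀ a b c d → DistinctIn (a ∷ b ∷ c ∷ d ∷ []) C → a ⊕ (b ⊕ (c ⊕ d)) ≢ 𝟎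

IsBx : ∀ {n} → List (V n) → V n → List (V n) → Set
IsBx B x L = DistinctIn L B × sumV L ≡ x

interSize : ∀ {n} → List (V n) → List (V n) → ℕ
interSize {n} L₁ L₂ = length (filter (λ y → y ∈? L₂) L₁)
  where open DecMem (_≟V_ {n}) using (_∈?_)

-- Write B_{x₁} = D₁ ⊔ I and B_{x₂} = D₂ ⊔ I with I = B_{x₁} ∩ B_{x₂}, so that
-- |D₁| = |D₂| = 5 − |I|.  Both sets lie in B, which has at most 8 elements, hence
-- 5 + |D₁| = |B_{x₁} ∪ B_{x₂}| ≤ 8.  If D₁ = D₂ = ∅ then x₁ = x₂; if D₁ = {a} and
-- D₂ = {b} then x₁ + x₂ = a + b, so {x₁, x₂, a, b} is a quad in C.  Thus |D₁| ∈ {2, 3}.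
-- The bound |B| ≤ 8 compares B with an 8-point basis B′ of C: the vectors (1, b), b ∈ B,
-- are linearly independent and lie in the span of the (1, b′), b′ ∈ B′, and distinct
-- coefficient vectors then give an injection of 2^|B| into 2^|B′|.

module Submission where

open import Defs
open import Level using (0ℓ)
open import Algebra.Bundles using (CommutativeMonoid)
open import Algebra.Structures using (IsCommutativeMonoid)
import Algebra.Properties.CommutativeSemigroup as CommutativeSemigroupProperties
open import Data.Bool using (Bool; true; false; not)
open import Data.Bool.Properties
  using (xor-assoc; xor-comm; xor-identityˡ; xor-identityʳ; xor-same; not-involutive)
open import Data.Empty using (⊥-elim)
open import Data.Fin using (Fin; zero; combine; remQuot)
open import Data.Fin.Properties using (2↔Bool; remQuot-combine; combine-remQuot; injective⇒≤)
open import Data.List using (List; []; _∷_; _++_; length; map; filter; foldr)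
open import Data.List.Properties using (length-++; length-map; length-filter)
open import Data.List.Membership.Propositional using (_∈_; _∉_)
open import Data.List.Membership.Propositional.Properties using (∈-filter⁺; ∈-filter⁻; ∈-map⁺)
open import Data.List.Membership.Propositional.Properties.WithK using (unique∧set⇒bag)
import Data.List.Membership.DecPropositional as DecMembership
open import Data.List.Relation.Binary.BagAndSetEquality using (∼bag⇒↭)
open import Data.List.Relation.Binary.Disjoint.Propositional using (Disjoint)
open import Data.List.Relation.Binary.Permutation.Propositional
  using (_↭_; ↭-refl; ↭-prep; ↭-trans; ↭-sym; ↭⇒↭ₛ)
open import Data.List.Relation.Binary.Permutation.Propositional.Properties
  using (↭-length; shift; ++⁺ˡ)
open import Data.List.Relation.Binary.Permutation.Setoid.Properties using (foldr-commMonoid)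
open import Data.List.Relation.Unary.All as All using (All; []; _∷_)
open import Data.List.Relation.Unary.All.Properties
  using () renaming (map⁺ to All-map⁺; filter⁺ to All-filter⁺; ++⁺ to All-++⁺)
open import Data.List.Relation.Unary.AllPairs using ([]; _∷_)
open import Data.List.Relation.Unary.Any using (here; there)
open import Data.List.Relation.Unary.Unique.Propositional using (Unique)
import Data.List.Relation.Unary.Unique.Propositional.Properties as Unique
open import Data.Nat using (ℕ; zero; suc; _+_; _^_; _≤_; z≤n; s≤s)
open import Data.Nat.Properties
  using (^-monoʳ-<; <⇒≱; ≮⇒≥; ≤-trans; +-cancelˡ-≤; +-cancelʳ-≡; module ≤-Reasoning)
open import Data.Product using (Σ-syntax; ∃; _×_; _,_; proj₁; proj₂)
open import Data.Sum using (_⊎_; inj₁; inj₂)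
open import Data.Unit using (⊤)
open import Data.Vec using ([]; _∷_)
open import Data.Vec.Properties
  using (zipWith-assoc; zipWith-comm; zipWith-identityˡ; zipWith-identityʳ; ∷-injective)
open import Function using (_∘_; Injective; _⇔_; mk⇔; Inverse)
open import Relation.Binary.Definitions using (DecidableEquality)
open import Relation.Binary.PropositionalEquality
open import Relation.Nullary using (yes; no; ¬?)

private
  variable
    n : ℕ

-- The group ℤ₂ⁿ

⊕-assoc : (x y z : V n) → (x ⊕ y) ⊕ z ≡ x ⊕ (y ⊕ z)
⊕-assoc = zipWith-assoc xor-assoc

⊕-comm : (x y : V n) → x ⊕ y ≡ y ⊕ x
⊕-comm = zipWith-comm xor-comm

⊕-identityˡ : (x : V n) → 𝟎 ⊕ x ≡ x
⊕-identityˡ = zipWith-identityˡ xor-identityˡ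

⊕-identityʳ : (x : V n) → x ⊕ 𝟎 ≡ x
⊕-identityʳ = zipWith-identityʳ xor-identityʳ

⊕-self : (x : V n) → x ⊕ x ≡ 𝟎
⊕-self []      = refl
⊕-self (b ∷ x) = cong₂ _∷_ (xor-same b) (⊕-self x)

⊕-isCommutativeMonoid : IsCommutativeMonoid {A = V n} _≡_ _⊕_ 𝟎
⊕-isCommutativeMonoid = record
  { isMonoid = record
    { isSemigroup = record
      { isMagma = record { isEquivalence = isEquivalence ; ∙-cong = cong₂ _⊕_ }
      ; assoc   = ⊕-assoc }
    ; identity = ⊕-identityˡ , ⊕-identityʳ }
  ; comm = ⊕-comm }

⊕-commutativeMonoid : ℕ → CommutativeMonoid 0ℓ 0ℓ
⊕-commutativeMonoid n = record { isCommutativeMonoid = ⊕-isCommutativeMonoid {n} }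

private
  module ⊕-Properties (n : ℕ) = CommutativeSemigroupProperties
    (CommutativeMonoid.commutativeSemigroup (⊕-commutativeMonoid n))

⊕-interchange : (w x y z : V n) → (w ⊕ x) ⊕ (y ⊕ z) ≡ (w ⊕ y) ⊕ (x ⊕ z)
⊕-interchange {n} = ⊕-Properties.interchange n

⊕-left-comm : (x y z : V n) → x ⊕ (y ⊕ z) ≡ y ⊕ (x ⊕ z)
⊕-left-comm {n} = ⊕-Properties.x∙yz≈y∙xz n

x⊕[x⊕y]≡y : (x y : V n) → x ⊕ (x ⊕ y) ≡ y
x⊕[x⊕y]≡y x y = begin
  x ⊕ (x ⊕ y)  ≡⟨ ⊕-assoc x x y ⟨
  (x ⊕ x) ⊕ y  ≡⟨ cong (_⊕ y) (⊕-self x) ⟩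
  𝟎 ⊕ y        ≡⟨ ⊕-identityˡ y ⟩
  y            ∎
  where open ≡-Reasoning

⊕-cancelˡ : (x : V n) {y z : V n} → x ⊕ y ≡ x ⊕ z → y ≡ z
⊕-cancelˡ x {y} {z} eq = begin
  y            ≡⟨ x⊕[x⊕y]≡y x y ⟨
  x ⊕ (x ⊕ y)  ≡⟨ cong (x ⊕_) eq ⟩
  x ⊕ (x ⊕ z)  ≡⟨ x⊕[x⊕y]≡y x z ⟩
  z            ∎
  where open ≡-Reasoning

[x⊕y]⊕[x⊕z]≡y⊕z : (x y z : V n) → (x ⊕ y) ⊕ (x ⊕ z) ≡ y ⊕ z
[x⊕y]⊕[x⊕z]≡y⊕z x y z = begin
  (x ⊕ y) ⊕ (x ⊕ z)  ≡⟨ ⊕-interchange x y x z ⟩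
  (x ⊕ x) ⊕ (y ⊕ z)  ≡⟨ cong (_⊕ (y ⊕ z)) (⊕-self x) ⟩
  𝟎 ⊕ (y ⊕ z)        ≡⟨ ⊕-identityˡ (y ⊕ z) ⟩
  y ⊕ z              ∎
  where open ≡-Reasoning

[x⊕z]⊕[y⊕z]≡x⊕y : (x y z : V n) → (x ⊕ z) ⊕ (y ⊕ z) ≡ x ⊕ y
[x⊕z]⊕[y⊕z]≡x⊕y x y z = begin
  (x ⊕ z) ⊕ (y ⊕ z)  ≡⟨ ⊕-interchange x z y z ⟩
  (x ⊕ y) ⊕ (z ⊕ z)  ≡⟨ cong ((x ⊕ y) ⊕_) (⊕-self z) ⟩
  (x ⊕ y) ⊕ 𝟎        ≡⟨ ⊕-identityʳ (x ⊕ y) ⟩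
  x ⊕ y              ∎
  where open ≡-Reasoning

sumV≡foldr : (xs : List (V n)) → sumV xs ≡ foldr _⊕_ 𝟎 xs
sumV≡foldr []       = refl
sumV≡foldr (x ∷ xs) = cong (x ⊕_) (sumV≡foldr xs)

sumV-↭ : {xs ys : List (V n)} → xs ↭ ys → sumV xs ≡ sumV ys
sumV-↭ {xs = xs} {ys} p = begin
  sumV xs          ≡⟨ sumV≡foldr xs ⟩
  foldr _⊕_ 𝟎 xs   ≡⟨ foldr-commMonoid (setoid _) ⊕-isCommutativeMonoid (↭⇒↭ₛ p) ⟩
  foldr _⊕_ 𝟎 ys   ≡⟨ sumV≡foldr ys ⟨
  sumV ys          ∎
  where open ≡-Reasoning

-- Linear combinations and a dimension count

lincomb : (A : List (V n)) → V (length A) → V n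
lincomb []      []          = 𝟎
lincomb (a ∷ A) (true  ∷ c) = a ⊕ lincomb A c
lincomb (a ∷ A) (false ∷ c) = lincomb A c

lincomb-𝟎 : (A : List (V n)) → lincomb A 𝟎 ≡ 𝟎
lincomb-𝟎 []      = refl
lincomb-𝟎 (a ∷ A) = lincomb-𝟎 A

lincomb-⊕ : (A : List (V n)) (c d : V (length A)) →
            lincomb A (c ⊕ d) ≡ lincomb A c ⊕ lincomb A d
lincomb-⊕ []      []          []          = sym (⊕-identityˡ 𝟎)
lincomb-⊕ (a ∷ A) (true  ∷ c) (true  ∷ d) =
  trans (lincomb-⊕ A c d) (sym ([x⊕y]⊕[x⊕z]≡y⊕z a _ _))
lincomb-⊕ (a ∷ A) (true  ∷ c) (false ∷ d) =
  trans (cong (a ⊕_) (lincomb-⊕ A c d)) (sym (⊕-assoc a _ _))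
lincomb-⊕ (a ∷ A) (false ∷ c) (true  ∷ d) =
  trans (cong (a ⊕_) (lincomb-⊕ A c d)) (⊕-left-comm a _ _)
lincomb-⊕ (a ∷ A) (false ∷ c) (false ∷ d) = lincomb-⊕ A c d

Span : List (V n) → V n → Set
Span A y = Σ[ c ∈ V (length A) ] lincomb A c ≡ y

Span-⊕ : (A : List (V n)) {x y : V n} → Span A x → Span A y → Span A (x ⊕ y)
Span-⊕ A (c , refl) (d , refl) = c ⊕ d , lincomb-⊕ A c d

Span-∈ : {A : List (V n)} {y : V n} → y ∈ A → Span A y
Span-∈ {A = a ∷ A} (here refl) = true ∷ 𝟎 , trans (cong (a ⊕_) (lincomb-𝟎 A)) (⊕-identityʳ a)
Span-∈ {A = a ∷ A} (there y∈A) with c , eq ← Span-∈ y∈A = false ∷ c , eq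

Span-sumV : (A : List (V n)) {xs : List (V n)} → All (_∈ A) xs → Span A (sumV xs)
Span-sumV A []           = 𝟎 , lincomb-𝟎 A
Span-sumV A (x∈A ∷ xs⊆A) = Span-⊕ A (Span-∈ x∈A) (Span-sumV A xs⊆A)

Span-lincomb : (A : List (V n)) {U : List (V n)} → All (Span A) U →
               (c : V (length U)) → Span A (lincomb U c)
Span-lincomb A []       []          = 𝟎 , lincomb-𝟎 A
Span-lincomb A (u ∷ us) (true  ∷ c) = Span-⊕ A u (Span-lincomb A us c)
Span-lincomb A (u ∷ us) (false ∷ c) = Span-lincomb A us c

Independent : List (V n) → Set
Independent []      = ⊤
Independent (u ∷ U) = (∀ c → lincomb U c ≢ u) × Independent U

lincomb-injective : (U : List (V n)) → Independent U → Injective _≡_ _≡_ (lincomb U)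
lincomb-injective []      _           {[]}        {[]}         _  = refl
lincomb-injective (u ∷ U) (_   , ind) {true ∷ c}  {true ∷ d}   eq =
  cong (true ∷_) (lincomb-injective U ind (⊕-cancelˡ u eq))
lincomb-injective (u ∷ U) (_   , ind) {false ∷ c} {false ∷ d}  eq =
  cong (false ∷_) (lincomb-injective U ind eq)
lincomb-injective (u ∷ U) (u∉U , _)   {true ∷ c}  {false ∷ d}  eq =
  ⊥-elim (u∉U (c ⊕ d) (begin
    lincomb U (c ⊕ d)                    ≡⟨ lincomb-⊕ U c d ⟩
    lincomb U c ⊕ lincomb U d            ≡⟨ cong (lincomb U c ⊕_) eq ⟨
    lincomb U c ⊕ (u ⊕ lincomb U c)      ≡⟨ ⊕-left-comm _ u _ ⟩
    u ⊕ (lincomb U c ⊕ lincomb U c)      ≡⟨ cong (u ⊕_) (⊕-self _) ⟩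
    u ⊕ 𝟎                                ≡⟨ ⊕-identityʳ u ⟩
    u                                    ∎))
  where open ≡-Reasoning
lincomb-injective (u ∷ U) ind         {false ∷ c} {true ∷ d}   eq =
  sym (lincomb-injective (u ∷ U) ind (sym eq))

private
  module Bit = Inverse 2↔Bool

vec→fin : ∀ {k} → V k → Fin (2 ^ k)
vec→fin []      = zero
vec→fin (b ∷ v) = combine (Bit.from b) (vec→fin v)

fin→vec : ∀ k → Fin (2 ^ k) → V k
fin→vec zero    _ = []
fin→vec (suc k) i = Bit.to (proj₁ qr) ∷ fin→vec k (proj₂ qr)
  where qr = remQuot {2} (2 ^ k) i

fin→vec-vec→fin : ∀ {k} (v : V k) → fin→vec k (vec→fin v) ≡ v
fin→vec-vec→fin []              = refl
fin→vec-vec→fin {suc k} (b ∷ v) = cong₂ _∷_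
  (trans (cong (Bit.to ∘ proj₁) split) (Bit.strictlyInverseˡ b))
  (trans (cong (fin→vec k ∘ proj₂) split) (fin→vec-vec→fin v))
  where split = remQuot-combine {2} {2 ^ k} (Bit.from b) (vec→fin v)

vec→fin-fin→vec : ∀ k (i : Fin (2 ^ k)) → vec→fin (fin→vec k i) ≡ i
vec→fin-fin→vec zero    zero = refl
vec→fin-fin→vec (suc k) i    =
  trans (cong₂ combine (Bit.strictlyInverseʳ (proj₁ qr)) (vec→fin-fin→vec k (proj₂ qr)))
        (combine-remQuot {2} (2 ^ k) i)
  where qr = remQuot {2} (2 ^ k) i

injective⇒length-≤ : ∀ {k j} (g : V k → V j) → Injective _≡_ _≡_ g → k ≤ j
injective⇒length-≤ {k} {j} g g-inj =
  ≮⇒≥ λ j<k → <⇒≱ (^-monoʳ-< 2 (s≤s (s≤s z≤n)) j<k) (injective⇒≤ h-inj)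
  where
  h : Fin (2 ^ k) → Fin (2 ^ j)
  h = vec→fin ∘ g ∘ fin→vec k
  h-inj : Injective _≡_ _≡_ h
  h-inj {i} {i′} eq = begin
    i                          ≡⟨ vec→fin-fin→vec k i ⟨
    vec→fin (fin→vec k i)      ≡⟨ cong vec→fin (g-inj (begin
      g (fin→vec k i)                    ≡⟨ fin→vec-vec→fin _ ⟨
      fin→vec j (h i)                    ≡⟨ cong (fin→vec j) eq ⟩
      fin→vec j (h i′)                   ≡⟨ fin→vec-vec→fin _ ⟩
      g (fin→vec k i′)                   ∎)) ⟩
    vec→fin (fin→vec k i′)     ≡⟨ vec→fin-fin→vec k i′ ⟩
    i′                         ∎
    where open ≡-Reasoning

independent-length-≤ : (A U : List (V n)) → Independent U → All (Span A) U →
                       length U ≤ length A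
independent-length-≤ A U ind U⊆span =
  injective⇒length-≤ coefficients λ {c} {d} eq → lincomb-injective U ind (begin
    lincomb U c                   ≡⟨ proj₂ (Span-lincomb A U⊆span c) ⟨
    lincomb A (coefficients c)    ≡⟨ cong (lincomb A) eq ⟩
    lincomb A (coefficients d)    ≡⟨ proj₂ (Span-lincomb A U⊆span d) ⟩
    lincomb U d                   ∎)
  where
  open ≡-Reasoning
  coefficients : V (length U) → V (length A)
  coefficients c = proj₁ (Span-lincomb A U⊆span c)

-- Affine independence

-- An odd sum of points (1, x) has first coordinate 1, so affine combinations of S
-- correspond exactly to linear combinations of augmented points with first coordinate 1.
augment : V n → V (suc n)
augment x = true ∷ x

isOdd : ℕ → Bool
isOdd zero    = false
isOdd (suc k) = not (isOdd k)

isOdd⇒Odd : ∀ k → isOdd k ≡ true → Odd k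
isOdd⇒Odd (suc zero)    _  = odd-one
isOdd⇒Odd (suc (suc k)) eq = odd-ss (isOdd⇒Odd k (trans (sym (not-involutive (isOdd k))) eq))

Odd⇒isOdd : ∀ {k} → Odd k → isOdd k ≡ true
Odd⇒isOdd odd-one          = refl
Odd⇒isOdd (odd-ss {k} odd) = trans (not-involutive (isOdd k)) (Odd⇒isOdd odd)

sumV-map-augment : (R : List (V n)) → sumV (map augment R) ≡ isOdd (length R) ∷ sumV R
sumV-map-augment []      = refl
sumV-map-augment (x ∷ R) = cong (augment x ⊕_) (sumV-map-augment R)

lincomb-map-augment : (T : List (V n)) → Unique T → (d : V (length (map augment T))) →
  ∃ λ R → DistinctIn R T × lincomb (map augment T) d ≡ sumV (map augment R)
lincomb-map-augment []      _             []          = [] , ([] , []) , refl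
lincomb-map-augment (t ∷ T) (t∉T ∷ uniqT) (false ∷ d)
  with R , (uniqR , R⊆T) , eq ← lincomb-map-augment T uniqT d =
  R , (uniqR , All.map there R⊆T) , eq
lincomb-map-augment (t ∷ T) (t∉T ∷ uniqT) (true ∷ d)
  with R , (uniqR , R⊆T) , eq ← lincomb-map-augment T uniqT d =
  t ∷ R , (All.map (All.lookup t∉T) R⊆T ∷ uniqR , here refl ∷ All.map there R⊆T)
        , cong (augment t ⊕_) eq

AffIndep⇒Independent-augment : {B : List (V n)} → AffIndep B →
  (T : List (V n)) → Unique T → All (_∈ B) T → Independent (map augment T)
AffIndep⇒Independent-augment indep []      _             _             = _
AffIndep⇒Independent-augment {B = B} indep (t ∷ T) (t∉T ∷ uniqT) (t∈B ∷ T⊆B) =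
  t∉span , AffIndep⇒Independent-augment indep T uniqT T⊆B
  where
  t∉span : ∀ d → lincomb (map augment T) d ≢ augment t
  t∉span d eq with R , (uniqR , R⊆T) , eq′ ← lincomb-map-augment T uniqT d
    with odd , sum ← ∷-injective (trans (sym (sumV-map-augment R)) (trans (sym eq′) eq)) =
    indep t t∈B (R , (uniqR , All.map R⊆B-t R⊆T) , isOdd⇒Odd _ odd , sum)
    where
    R⊆B-t : ∀ {r} → r ∈ T → r ∈ remove t B
    R⊆B-t r∈T = ∈-filter⁺ (λ y → ¬? (y ≟V t)) (All.lookup T⊆B r∈T)
                          (λ r≡t → All.lookup t∉T r∈T (sym r≡t))

InAff⇒Span-augment : {A : List (V n)} {x : V n} → InAff A x → Span (map augment A) (augment x)
InAff⇒Span-augment {A = A} (L , (_ , L⊆A) , odd , refl) =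
  subst (Span (map augment A)) (trans (sumV-map-augment L) (cong (_∷ sumV L) (Odd⇒isOdd odd)))
        (Span-sumV (map augment A) (All-map⁺ (All.map (∈-map⁺ augment) L⊆A)))

affIndep-length-≤ : {A B : List (V n)} → Unique B → AffIndep B → All (InAff A) B →
                    length B ≤ length A
affIndep-length-≤ {A = A} {B} uniqB indep B⊆affA =
  subst₂ _≤_ (length-map augment B) (length-map augment A)
    (independent-length-≤ (map augment A) (map augment B)
      (AffIndep⇒Independent-augment indep B uniqB (All.tabulate λ b∈B → b∈B))
      (All-map⁺ (All.map InAff⇒Span-augment B⊆affA)))

InAff-∈ : {S : List (V n)} {x : V n} → x ∈ S → InAff S x
InAff-∈ {x = x} x∈S = x ∷ [] , (([] ∷ []) , x∈S ∷ []) , odd-one , ⊕-identityʳ x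

basis-length-≤ : {C B : List (V n)} {d : ℕ} → HasDim C d → IsBasis B C → length B ≤ suc d
basis-length-≤ {B = B} (B′ , (_ , _ , _ , affC⇔affB′) , |B′|≡1+d) (uniqB , B⊆C , indepB , _) =
  subst (length B ≤_) |B′|≡1+d
    (affIndep-length-≤ uniqB indepB (All.map (λ b∈C → proj₂ (affC⇔affB′ _) (InAff-∈ b∈C)) B⊆C))

-- Finite sets as duplicate-free lists

module ListSet {A : Set} (_≟_ : DecidableEquality A) where

  open DecMembership _≟_ using (_∈?_; _∉?_)

  infixl 7 _∩_
  infixl 6 _∖_

  _∩_ : List A → List A → List A
  xs ∩ ys = filter (_∈? ys) xs

  _∖_ : List A → List A → List A
  xs ∖ ys = filter (_∉? ys) xs

  ↭-∖++∩ : ∀ xs ys → xs ↭ xs ∖ ys ++ xs ∩ ys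
  ↭-∖++∩ []       ys = ↭-refl
  ↭-∖++∩ (x ∷ xs) ys with x ∈? ys
  ... | yes _ = ↭-trans (↭-prep x (↭-∖++∩ xs ys)) (↭-sym (shift x (xs ∖ ys) (xs ∩ ys)))
  ... | no  _ = ↭-prep x (↭-∖++∩ xs ys)

  ∖-⊆ : ∀ {v xs ys} → v ∈ xs ∖ ys → v ∈ xs
  ∖-⊆ {xs = xs} {ys} = proj₁ ∘ ∈-filter⁻ (_∉? ys) {xs = xs}

  ∖-disjoint : ∀ {xs ys} → Disjoint ys (xs ∖ ys)
  ∖-disjoint {xs} {ys} (v∈ys , v∈xs∖ys) = proj₂ (∈-filter⁻ (_∉? ys) {xs = xs} v∈xs∖ys) v∈ys

  ∖-disjoint-∖ : ∀ {xs ys} → Disjoint (xs ∖ ys) (ys ∖ xs)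
  ∖-disjoint-∖ {xs} {ys} (v∈xs∖ys , v∈ys∖xs) =
    ∖-disjoint {xs} {ys} (∖-⊆ {xs = ys} {xs} v∈ys∖xs , v∈xs∖ys)

  same-members⇒↭ : {xs ys : List A} → Unique xs → Unique ys →
                   (∀ {v} → v ∈ xs ⇔ v ∈ ys) → xs ↭ ys
  same-members⇒↭ uniq-xs uniq-ys same = ∼bag⇒↭ (unique∧set⇒bag uniq-xs uniq-ys same)

  ∩-comm-↭ : {xs ys : List A} → Unique xs → Unique ys → xs ∩ ys ↭ ys ∩ xs
  ∩-comm-↭ {xs} {ys} uniq-xs uniq-ys =
    same-members⇒↭ (Unique.filter⁺ _ uniq-xs) (Unique.filter⁺ _ uniq-ys)
                   (mk⇔ (∈-∩-swap xs ys) (∈-∩-swap ys xs))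
    where
    ∈-∩-swap : ∀ us ws {v} → v ∈ us ∩ ws → v ∈ ws ∩ us
    ∈-∩-swap us ws v∈ with v∈us , v∈ws ← ∈-filter⁻ (_∈? ws) {xs = us} v∈ =
      ∈-filter⁺ (_∈? us) v∈ws v∈us

  unique-⊆⇒length-≤ : {xs ys : List A} → Unique xs → Unique ys → All (_∈ ys) xs →
                      length xs ≤ length ys
  unique-⊆⇒length-≤ {xs} {ys} uniq-xs uniq-ys xs⊆ys = begin
    length xs         ≡⟨ ↭-length xs↭ys∩xs ⟩
    length (ys ∩ xs)  ≤⟨ length-filter (_∈? xs) ys ⟩
    length ys         ∎
    where
    open ≤-Reasoning
    xs↭ys∩xs : xs ↭ ys ∩ xs
    xs↭ys∩xs = same-members⇒↭ uniq-xs (Unique.filter⁺ _ uniq-ys) (mk⇔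
      (λ v∈xs → ∈-filter⁺ (_∈? xs) (All.lookup xs⊆ys v∈xs) v∈xs)
      (proj₂ ∘ ∈-filter⁻ (_∈? xs) {xs = ys}))

  length-∪-≤ : {xs ys zs : List A} → Unique xs → Unique ys → Unique zs →
               All (_∈ zs) xs → All (_∈ zs) ys → length ys + length (xs ∖ ys) ≤ length zs
  length-∪-≤ {xs} {ys} {zs} uniq-xs uniq-ys uniq-zs xs⊆zs ys⊆zs = begin
    length ys + length (xs ∖ ys)  ≡⟨ length-++ ys ⟨
    length (ys ++ xs ∖ ys)        ≤⟨ unique-⊆⇒length-≤ uniq-ys++xs∖ys uniq-zs
                                      (All-++⁺ ys⊆zs (All-filter⁺ _ xs⊆zs)) ⟩
    length zs                     ∎
    where
    open ≤-Reasoning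
    uniq-ys++xs∖ys : Unique (ys ++ xs ∖ ys)
    uniq-ys++xs∖ys = Unique.++⁺ uniq-ys (Unique.filter⁺ _ uniq-xs) (∖-disjoint {xs} {ys})

-- Caps

cap-pair-sums-distinct : {C : List (V n)} {x₁ x₂ a b : V n} → IsCap C →
                         DistinctIn (x₁ ∷ x₂ ∷ a ∷ b ∷ []) C → x₁ ⊕ x₂ ≢ a ⊕ b
cap-pair-sums-distinct {x₁ = x₁} {x₂} {a} {b} cap quad eq = cap x₁ x₂ a b quad (begin
  x₁ ⊕ (x₂ ⊕ (a ⊕ b))  ≡⟨ ⊕-assoc x₁ x₂ (a ⊕ b) ⟨
  (x₁ ⊕ x₂) ⊕ (a ⊕ b)  ≡⟨ cong (_⊕ (a ⊕ b)) eq ⟩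
  (a ⊕ b) ⊕ (a ⊕ b)    ≡⟨ ⊕-self (a ⊕ b) ⟩
  𝟎                    ∎)
  where open ≡-Reasoning

cap-differences-≥2 : {C B : List (V n)} {x₁ x₂ : V n} → IsCap C → B ⊆ C →
  x₁ ∈ C → x₁ ∉ B → x₂ ∈ C → x₂ ∉ B → x₁ ≢ x₂ →
  (D₁ D₂ I : List (V n)) → D₁ ⊆ B → D₂ ⊆ B → Disjoint D₁ D₂ →
  sumV (D₁ ++ I) ≡ x₁ → sumV (D₂ ++ I) ≡ x₂ → length D₁ ≡ length D₂ → 2 ≤ length D₁
cap-differences-≥2 _ _ _ _ _ _ x₁≢x₂ [] [] _ _ _ _ sum₁ sum₂ _ =
  ⊥-elim (x₁≢x₂ (trans (sym sum₁) sum₂))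
cap-differences-≥2 {B = B} {x₁} {x₂} cap B⊆C x₁∈C x₁∉B x₂∈C x₂∉B x₁≢x₂
                   (a ∷ []) (b ∷ []) I (a∈B ∷ []) (b∈B ∷ []) disjoint sum₁ sum₂ _ =
  ⊥-elim (cap-pair-sums-distinct cap (distinct , x₁∈C ∷ x₂∈C ∷ ∈C a∈B ∷ ∈C b∈B ∷ []) sums)
  where
  ∈C = All.lookup B⊆C
  ≢-∈ : ∀ {x y} → x ∉ B → y ∈ B → x ≢ y
  ≢-∈ x∉B y∈B refl = x∉B y∈B
  a≢b : a ≢ b
  a≢b refl = disjoint (here refl , here refl)
  distinct : Unique (x₁ ∷ x₂ ∷ a ∷ b ∷ [])
  distinct = (x₁≢x₂ ∷ ≢-∈ x₁∉B a∈B ∷ ≢-∈ x₁∉B b∈B ∷ [])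
           ∷ (≢-∈ x₂∉B a∈B ∷ ≢-∈ x₂∉B b∈B ∷ []) ∷ (a≢b ∷ []) ∷ [] ∷ []
  sums : x₁ ⊕ x₂ ≡ a ⊕ b
  sums = trans (cong₂ _⊕_ (sym sum₁) (sym sum₂)) ([x⊕z]⊕[y⊕z]≡x⊕y a b (sumV I))
cap-differences-≥2 _ _ _ _ _ _ _ (_ ∷ _ ∷ _) _ _ _ _ _ _ _ _ = s≤s (s≤s z≤n)

five-minus-2-or-3 : ∀ d k → d + k ≡ 5 → 2 ≤ d → d ≤ 3 → k ≡ 2 ⊎ k ≡ 3
five-minus-2-or-3 0 _ _ () _
five-minus-2-or-3 1 _ _ (s≤s ()) _
five-minus-2-or-3 2 _ refl _ _ = inj₂ refl
five-minus-2-or-3 3 _ refl _ _ = inj₁ refl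
five-minus-2-or-3 (suc (suc (suc (suc _)))) _ _ _ (s≤s (s≤s (s≤s ())))

lemma4p2 : ∀ {n} (C B : List (V n))
    → Unique C → IsCap C → HasDim C 7 → IsBasis B C
    → (x₁ x₂ : V n) → x₁ ∈ C → x₁ ∉ B → x₂ ∈ C → x₂ ∉ B → x₁ ≢ x₂
    → (L₁ L₂ : List (V n)) → IsBx B x₁ L₁ → length L₁ ≡ 5
    → IsBx B x₂ L₂ → length L₂ ≡ 5
    → interSize L₁ L₂ ≡ 2 ⊎ interSize L₁ L₂ ≡ 3
lemma4p2 C B _ cap dim basis@(uniqB , B⊆C , _) x₁ x₂ x₁∈C x₁∉B x₂∈C x₂∉B x₁≢x₂
         L₁ L₂ ((uniqL₁ , L₁⊆B) , sum₁) |L₁|≡5 ((uniqL₂ , L₂⊆B) , sum₂) |L₂|≡5 =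
  five-minus-2-or-3 (length D₁) (length I) (|D|+|I|≡5 L₁↭ |L₁|≡5) 2≤|D₁| |D₁|≤3
  where
  open ListSet _≟V_
  D₁ = L₁ ∖ L₂
  D₂ = L₂ ∖ L₁
  I  = L₁ ∩ L₂
  L₁↭ : L₁ ↭ D₁ ++ I
  L₁↭ = ↭-∖++∩ L₁ L₂
  L₂↭ : L₂ ↭ D₂ ++ I
  L₂↭ = ↭-trans (↭-∖++∩ L₂ L₁) (++⁺ˡ D₂ (∩-comm-↭ uniqL₂ uniqL₁))
  |D|+|I|≡5 : ∀ {L D} → L ↭ D ++ I → length L ≡ 5 → length D + length I ≡ 5
  |D|+|I|≡5 {D = D} L↭ |L|≡5 = trans (sym (length-++ D)) (trans (sym (↭-length L↭)) |L|≡5)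
  |D₁|≤3 : length D₁ ≤ 3
  |D₁|≤3 = +-cancelˡ-≤ 5 _ _ (subst (λ l → l + length D₁ ≤ 8) |L₂|≡5
    (≤-trans (length-∪-≤ uniqL₁ uniqL₂ uniqB L₁⊆B L₂⊆B) (basis-length-≤ dim basis)))
  2≤|D₁| : 2 ≤ length D₁
  2≤|D₁| = cap-differences-≥2 cap B⊆C x₁∈C x₁∉B x₂∈C x₂∉B x₁≢x₂ D₁ D₂ I
    (All-filter⁺ _ L₁⊆B) (All-filter⁺ _ L₂⊆B) (∖-disjoint-∖ {L₁} {L₂})
    (trans (sym (sumV-↭ L₁↭)) sum₁) (trans (sym (sumV-↭ L₂↭)) sum₂)
    (+-cancelʳ-≡ _ _ _ (trans (|D|+|I|≡5 L₁↭ |L₁|≡5) (sym (|D|+|I|≡5 L₂↭ |L₂|≡5))))
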